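{- Let $t\geq 1$ and let $DT_t(u)$ be a $t$-diagnosis-tree rooted at $u$. Let $F\subseteq V(DT_t(u))$ be a faulty set with $|F|\leq t$. Then, for every outcome of the tests consistent with the BGM model for the faulty set $F$, the algorithm LDA, which uses two test rounds, returns $1$ if $u\in F$ and returns $0$ if $u\notin F$; that is, the faulty/fault-free status of $u$ is identified accurately in two test rounds.
   Context: A $t$-diagnosis-tree $DT_t(u)$ is a tree with $2t+1$ distinct nodes $u,x_1,\ldots,x_t,y_1,\ldots,y_t$ and edge set $\{\{u,x_i\},\{x_i,y_i\}\mid 1\leq i\leq t\}$. For adjacent nodes $a,b$, the test $(a,b)$ means $a$ tests $b$ and yields a result $\sigma(a,b)\in\{0,1\}$. BGM model, for a faulty set $F$: if $a\notin F$ then $\sigma(a,b)=1$ iff $b\in F$; if $a,b\in F$ then $\sigma(a,b)=1$; if $a\in F$ and $b\notin F$ then $\sigma(a,b)$ may be $0$ or $1$ (arbitrary). Algorithm LDA: Round 1: perform the tests $(y_i,x_i)$ for all $1\leq i\leq t$ and let $A=\{x_i\mid \sigma(y_i,x_i)=0\}$. If $A\neq\emptyset$, choose any $z\in A$, and in Round 2 perform the test $(z,u)$; return $0$ if $\sigma(z,u)=0$ and $1$ otherwise. If $A=\emptyset$, return $0$. -}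

module Defs where

open import Data.Nat using (ℕ; _+_)
open import Data.Fin using (Fin)
open import Data.Bool using (Bool; true; false)
open import Data.List using (List; _∷_; []; map; _++_; length; filter; allFin)
open import Data.Product using (_×_; ∃; ∃-syntax)
open import Data.Sum using (_⊎_)
open import Relation.Binary.PropositionalEquality using (_≡_)
open import Relation.Nullary using (Dec)
open import Data.Bool using (T; T?)

data Node (t : ℕ) : Set where
  root : Node t
  x    : Fin t → Node t
  y    : Fin t → Node t

data Adj {t : ℕ} : Node t → Node t → Set where
  u-x : ∀ i → Adj root (x i)
  x-u : ∀ i → Adj (x i) root
  x-y : ∀ i → Adj (x i) (y i)
  y-x : ∀ i → Adj (y i) (x i)

Subset : ℕ → Set
Subset t = Node t → Bool

allNodes : (t : ℕ) → List (Node t)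
allNodes t = root ∷ (map x (allFin t) ++ map y (allFin t))

card : {t : ℕ} → Subset t → ℕ
card {t} F = length (filter (λ v → T? (F v)) (allNodes t))

-- Test outcomes: σ a b is the result of a testing b (true = 1, false = 0).
Syndrome : ℕ → Set
Syndrome t = Node t → Node t → Bool

BGM-consistent : {t : ℕ} → Subset t → Syndrome t → Set
BGM-consistent {t} F σ =
  ∀ (a b : Node t) → Adj a b →
    (F a ≡ false → σ a b ≡ F b) ×
    (F a ≡ true → F b ≡ true → σ a b ≡ true)

-- LDA-returns σ r : some run of algorithm LDA (for some admissible choice of
-- z ∈ A) on test outcomes σ returns r.
--   Round 1: tests (y_i,x_i); A = {x_i | σ(y_i,x_i) = 0}.
--   If A ≠ ∅: pick z = x_i ∈ A, Round 2 test (z,u), return σ(z,u).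
data LDA-returns {t : ℕ} (σ : Syndrome t) : Bool → Set where
  A-empty  : (∀ i → σ (y i) (x i) ≡ true) → LDA-returns σ false
  choose-z : ∀ i → σ (y i) (x i) ≡ false → LDA-returns σ (σ (x i) root)

{-# OPTIONS --safe #-}
module Submission where

-- A fault-free tester reports exactly the status of the tested node, and two faulty nodes
-- always report each other, so a test with outcome 0 certifies that the tested node is
-- fault-free and a test with outcome 1 implicates one of its two endpoints. If some
-- σ(yᵢ,xᵢ) = 0, then xᵢ is fault-free and σ(xᵢ,u) is the status of u. If every
-- σ(yᵢ,xᵢ) = 1, then each of the t disjoint pairs {xᵢ,yᵢ} contains a faulty node, so a
-- faulty u would give |F| ≥ t + 1.

open import Defs
open import Data.Nat using (ℕ; _≤_; _≥_; _<_; suc; _+_; z≤n; s≤s)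
open import Data.Nat.Properties
  using (≤-trans; ≤-reflexive; n≤1+n; n<1+n; +-suc; +-monoʳ-≤; <⇒≱; module ≤-Reasoning)
open import Data.Bool using (true; false; T; T?; _≟_)
open import Data.Bool.Properties using (T-≡; ¬-not)
open import Data.Fin.Properties using (all?; ¬∀⟶∃¬)
open import Data.List using (List; []; _∷_; map; filter; length; allFin; _++_)
open import Data.List.Properties using (filter-++; filter-accept; length-++; length-tabulate)
open import Data.Product using (_×_; ∃; _,_; proj₁; proj₂)
open import Data.Sum using (_⊎_; inj₁; inj₂)
import Data.Sum as Sum
open import Function using (_∘_; id; Equivalence)
open import Relation.Binary.PropositionalEquality using (_≡_; refl; sym; trans; cong)
open import Relation.Nullary using (yes; no; contradiction)
open import Relation.Unary using (Pred; Decidable)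

length-≤-filter-map-cover :
  ∀ {a b p} {A : Set a} {B : Set b} {P : Pred A p} (P? : Decidable P) (f g : B → A) →
  (∀ i → P (f i) ⊎ P (g i)) → (l : List B) →
  length l ≤ length (filter P? (map f l)) + length (filter P? (map g l))
length-≤-filter-map-cover P? f g cover [] = z≤n
length-≤-filter-map-cover P? f g cover (i ∷ l)
  with P? (f i) | P? (g i) | cover i | length-≤-filter-map-cover P? f g cover l
... | yes _ | yes _ | _        | ih = s≤s (≤-trans ih (+-monoʳ-≤ _ (n≤1+n _)))
... | yes _ | no _  | _        | ih = s≤s ih
... | no _  | yes _ | _        | ih = ≤-trans (s≤s ih) (≤-reflexive (sym (+-suc _ _)))
... | no ¬p | no _  | inj₁ p   | _  = contradiction p ¬p
... | no _  | no ¬q | inj₂ q   | _  = contradiction q ¬q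

module _ {t : ℕ} (F : Subset t) where

  faulty? : Decidable (T ∘ F)
  faulty? v = T? (F v)

  card-root-faulty : F root ≡ true →
    card F ≡ suc (length (filter faulty? (map x (allFin t) ++ map y (allFin t))))
  card-root-faulty root-faulty =
    cong length (filter-accept faulty? (Equivalence.from T-≡ root-faulty))

  card-> : F root ≡ true → (∀ i → F (x i) ≡ true ⊎ F (y i) ≡ true) → t < card F
  card-> root-faulty pair-faulty = begin-strict
    t                                       ≡⟨ sym (length-tabulate id) ⟩
    length (allFin t)                       ≤⟨ length-≤-filter-map-cover faulty? x y cover (allFin t) ⟩
    length xs′ + length ys′                 ≡⟨ sym (length-++ xs′) ⟩
    length (xs′ ++ ys′)                     ≡⟨ cong length (sym (filter-++ faulty? xs ys)) ⟩
    length (filter faulty? (xs ++ ys))      <⟨ n<1+n _ ⟩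
    suc (length (filter faulty? (xs ++ ys))) ≡⟨ sym (card-root-faulty root-faulty) ⟩
    card F                                  ∎
    where
    open ≤-Reasoning
    xs = map x (allFin t)
    ys = map y (allFin t)
    xs′ = filter faulty? xs
    ys′ = filter faulty? ys
    cover : ∀ i → T (F (x i)) ⊎ T (F (y i))
    cover = Sum.map (Equivalence.from T-≡) (Equivalence.from T-≡) ∘ pair-faulty

  root-fault-free : card F ≤ t → (∀ i → F (x i) ≡ true ⊎ F (y i) ≡ true) → F root ≡ false
  root-fault-free card≤t pair-faulty =
    ¬-not λ root-faulty → <⇒≱ (card-> root-faulty pair-faulty) card≤t

module _ {t : ℕ} {F : Subset t} {σ : Syndrome t} (consistent : BGM-consistent F σ)
         {a b : Node t} (adj : Adj a b) where

  faulty⇒test-positive : F b ≡ true → σ a b ≡ true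
  faulty⇒test-positive b-faulty with F a in e
  ... | true  = proj₂ (consistent a b adj) e b-faulty
  ... | false = trans (proj₁ (consistent a b adj) e) b-faulty

  test-negative⇒fault-free : σ a b ≡ false → F b ≡ false
  test-negative⇒fault-free negative =
    ¬-not λ b-faulty → contradiction (trans (sym negative) (faulty⇒test-positive b-faulty)) λ ()

  test-positive⇒faulty-endpoint : σ a b ≡ true → F a ≡ true ⊎ F b ≡ true
  test-positive⇒faulty-endpoint positive with F a in e
  ... | true  = inj₁ refl
  ... | false = inj₂ (trans (sym (proj₁ (consistent a b adj) e)) positive)

LDA-terminates : ∀ {t} (σ : Syndrome t) → ∃ (LDA-returns σ)
LDA-terminates {t} σ with all? (λ i → σ (y i) (x i) ≟ true)
... | yes all-positive = false , A-empty all-positive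
... | no ¬all-positive with ¬∀⟶∃¬ t _ (λ i → σ (y i) (x i) ≟ true) ¬all-positive
...   | i , not-positive = σ (x i) root , choose-z i (¬-not not-positive)

theorem4p4 : (t : ℕ) → t ≥ 1 → (F : Subset t) → card F ≤ t →
             (σ : Syndrome t) → BGM-consistent F σ →
             (∃ λ r → LDA-returns σ r) ×
             (∀ r → LDA-returns σ r → r ≡ F root)
theorem4p4 t _ F card≤t σ consistent = LDA-terminates σ , LDA-correct
  where
  LDA-correct : ∀ r → LDA-returns σ r → r ≡ F root
  LDA-correct .false (A-empty all-positive) =
    sym (root-fault-free F card≤t λ i →
      Sum.swap (test-positive⇒faulty-endpoint consistent (y-x i) (all-positive i)))
  LDA-correct .(σ (x i) root) (choose-z i negative) =
    proj₁ (consistent (x i) root (x-u i)) (test-negative⇒fault-free consistent (y-x i) negative)
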